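{- For every integer $k\ge1$, $2d([k-1])\ge d([k])$, and the inequality is strict for $k>1$.
   Context: $\mathbb{N}=\{0,1,2,\ldots\}$, $[k]=\{0,1,\ldots,k\}$, $A+B=\{a+b:a\in A,b\in B\}$. For a finite set $C\subseteq\mathbb{N}$, $d(C)$ is the number of sets $A\subseteq\mathbb{N}$ for which there exists $B\subseteq\mathbb{N}$ with $C=A+B$. -}

module Defs where

open import Data.Nat using (ℕ; zero; suc; _∸_; _≤ᵇ_)
open import Data.Bool using (Bool; true; false; _∧_)
open import Data.List using (List; length; upTo)
open import Data.Bool.ListAction using (any)
open import Data.List.Relation.Unary.All using (All)
open import Data.List.Relation.Unary.Any using (Any)
open import Data.List.Relation.Unary.AllPairs using (AllPairs)
open import Data.Product using (Σ; _×_)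
open import Relation.Binary.PropositionalEquality using (_≡_)
open import Relation.Nullary using (¬_)

NSet : Set
NSet = ℕ → Bool

_≐_ : NSet → NSet → Set
A ≐ B = ∀ n → A n ≡ B n

-- Sumset A + B = { a + b : a ∈ A, b ∈ B }:  n ∈ A + B  iff  ∃ i ≤ n, i ∈ A and n - i ∈ B.
_⊕_ : NSet → NSet → NSet
(A ⊕ B) n = any (λ i → A i ∧ B (n ∸ i)) (upTo (suc n))

⟦_⟧ : ℕ → NSet
⟦ k ⟧ n = n ≤ᵇ k

Summand : NSet → NSet → Set
Summand C A = Σ NSet (λ B → C ≐ (A ⊕ B))

HasCard : (NSet → Set) → ℕ → Set
HasCard P n =
  Σ (List NSet) (λ xs →
    (length xs ≡ n) ×
    All P xs ×
    AllPairs (λ A B → ¬ (A ≐ B)) xs ×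
    (∀ A → P A → Any (λ X → A ≐ X) xs))

DCount : NSet → ℕ → Set
DCount C n = HasCard (Summand C) n

-- A is a summand of [k] iff [k] = A + [t] for some t (B may be replaced by [max B]).
-- Such an A satisfies 0 ∈ A ⊆ [k], so d([k]) counts bit strings 1u of length k + 1.
-- For a summand A of [k + 1] with 1 ∈ A, dropping 0 and shifting down is a bijection
-- onto the summands of [k]; if 1 ∉ A, deleting the gap at 1 still gives a summand
-- of [k], injectively. Hence d([k + 1]) = d([k]) + g with g ≤ d([k]). For k ≥ 1 the
-- inequality is strict: [k] is a summand of [k], but {0} ∪ [2, k + 1] is not a summand
-- of [k + 1], since its top element forces t = 0.
module Submission where

open import Defs
open import Data.Bool using (Bool; true; false; T; _∧_)
open import Data.Bool.Properties using (T-∧; T?)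
open import Data.Empty using (⊥-elim)
open import Data.List using (List; []; _∷_; _++_; map; length; filter; replicate; applyUpTo; upTo)
open import Data.List.Properties
  using (length-++; length-map; filter-++; filter-≐; filter-none; length-filter; filter-notAll; length-applyUpTo; length-replicate)
open import Data.List.Membership.Propositional using (_∈_; find; lose)
open import Data.List.Membership.Propositional.Properties
  using (∈-upTo⁺; ∈-upTo⁻; ∈-map⁺; ∈-++⁺ˡ; ∈-++⁺ʳ; ∈-filter⁺)
open import Data.List.Relation.Unary.All as All using ([])
open import Data.List.Relation.Unary.All.Properties using (all-filter)
import Data.List.Relation.Unary.All.Properties as All
open import Data.List.Relation.Unary.Any as Any using (Any; here)
open import Data.List.Relation.Unary.Any.Properties using (any⁺; any⁻)
open import Data.List.Relation.Unary.AllPairs as AllPairs using (AllPairs; []; _∷_)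
import Data.List.Relation.Unary.AllPairs.Properties as AllPairs
open import Data.Nat using (ℕ; zero; suc; _+_; _∸_; _*_; _≤_; _<_; z≤n; s≤s; _≤?_)
open import Data.Nat.Properties
  using (≤-refl; ≤-trans; ≤-antisym; ≤-pred; <⇒≤; <-≤-trans; m≤n⇒m≤1+n; m≤n⇒m<n∨m≡n; n≤0⇒n≡0;
         ≤ᵇ⇒≤; ≤⇒≤ᵇ; m≤m+n; m+n≤o⇒m≤o; m+n≤o⇒n≤o; m≤n+o⇒m∸n≤o; m+n∸m≡n; m+[n∸m]≡n;
         +-identityʳ; +-monoʳ-≤; +-monoʳ-<; +-cancelˡ-≤; allUpTo?; anyUpTo?)
open import Data.Sum using (inj₁; inj₂)
open import Data.Product using (Σ; ∃₂; ∃-syntax; _×_; _,_; proj₁; proj₂)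
open import Function using (_∘_; case_of_; Equivalence)
open import Level using (Level)
open import Relation.Binary.PropositionalEquality using (_≡_; refl; sym; trans; cong; cong₂; subst; module ≡-Reasoning)
open import Relation.Nullary using (¬_; Dec; yes; no; does; contradiction)
open import Relation.Nullary.Decidable using (map′; _×-dec_; _→-dec_)
open import Relation.Unary using (Pred; Decidable; _⊆_) renaming (_≐_ to _≐ᵖ_)

private
  variable
    ℓ ℓ′ ℓˣ ℓʸ : Level
    X : Set ℓˣ
    Y : Set ℓʸ
    A B : NSet
    k t n : ℕ

≐-intro : (∀ n → T (A n) → T (B n)) → (∀ n → T (B n) → T (A n)) → A ≐ B
≐-intro {A} {B} A⊆B B⊆A n with A n | B n | A⊆B n | B⊆A n
... | false | false | _ | _ = refl
... | false | true  | _ | f = ⊥-elim (f _)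
... | true  | false | f | _ = ⊥-elim (f _)
... | true  | true  | _ | _ = refl

∈-⊕⁺ : ∀ A B {a b} → T (A a) → T (B b) → T ((A ⊕ B) (a + b))
∈-⊕⁺ A B {a} {b} Aa Bb =
  any⁺ (λ i → A i ∧ B (a + b ∸ i)) (lose (∈-upTo⁺ (s≤s (m≤m+n a b))) (Equivalence.from T-∧ (Aa , Bb′)))
  where
  Bb′ : T (B (a + b ∸ a))
  Bb′ = subst (T ∘ B) (sym (m+n∸m≡n a b)) Bb

∈-⊕⁻ : ∀ A B n → T ((A ⊕ B) n) → ∃₂ λ a b → T (A a) × T (B b) × a + b ≡ n
∈-⊕⁻ A B n n∈A⊕B with i , i∈ , Ai∧B ← find (any⁻ _ (upTo (suc n)) n∈A⊕B) =
  i , n ∸ i , proj₁ (Equivalence.to T-∧ Ai∧B) , proj₂ (Equivalence.to T-∧ Ai∧B) ,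
  m+[n∸m]≡n (≤-pred (∈-upTo⁻ i∈))

-- [k] = A + [t], unfolded pointwise.
Covers : ℕ → ℕ → NSet → Set
Covers k t A =
  (∀ a → T (A a) → a + t ≤ k) ×
  (∀ n → n ≤ k → ∃[ a ] a ≤ n × T (A a) × n ≤ a + t)

Coverable : ℕ → NSet → Set
Coverable k A = ∃[ t ] Covers k t A

covers⇒0∈ : Covers k t A → T (A 0)
covers⇒0∈ (_ , cover) with cover 0 z≤n
... | .0 , z≤n , A0 , _ = A0

covers⇒t≤k : Covers k t A → t ≤ k
covers⇒t≤k c@(bound , _) = bound 0 (covers⇒0∈ c)

covers⇒⊆ : Covers k t A → ∀ a → T (A a) → a ≤ k
covers⇒⊆ (bound , _) a Aa = m+n≤o⇒m≤o a (bound a Aa)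

covers-resp-≐ : ∀ {A′} → A ≐ A′ → Covers k t A → Covers k t A′
covers-resp-≐ A≐A′ (bound , cover) =
  (λ a A′a → bound a (subst T (sym (A≐A′ a)) A′a)) ,
  (λ n n≤k → let a , a≤n , Aa , n≤a+t = cover n n≤k in a , a≤n , subst T (A≐A′ a) Aa , n≤a+t)

covers⇒summand : Covers k t A → Summand ⟦ k ⟧ A
covers⇒summand {k} {t} {A} (bound , cover) = ⟦ t ⟧ , ≐-intro to from
  where
  to : ∀ n → T (⟦ k ⟧ n) → T ((A ⊕ ⟦ t ⟧) n)
  to n n≤k with a , a≤n , Aa , n≤a+t ← cover n (≤ᵇ⇒≤ n k n≤k) =
    subst (T ∘ (A ⊕ ⟦ t ⟧)) (m+[n∸m]≡n a≤n) (∈-⊕⁺ A ⟦ t ⟧ Aa (≤⇒≤ᵇ (m≤n+o⇒m∸n≤o n a n≤a+t)))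
  from : ∀ n → T ((A ⊕ ⟦ t ⟧) n) → T (⟦ k ⟧ n)
  from n n∈ with a , b , Aa , b≤t , refl ← ∈-⊕⁻ A ⟦ t ⟧ n n∈ =
    ≤⇒≤ᵇ (≤-trans (+-monoʳ-≤ a (≤ᵇ⇒≤ b t b≤t)) (bound a Aa))

greatest : ∀ k (P : NSet) → T (P 0) → ∃[ m ] T (P m) × (∀ n → n ≤ k → T (P n) → n ≤ m)
greatest zero    P P0 = 0 , P0 , λ n n≤0 _ → n≤0
greatest (suc k) P P0 with T? (P (suc k)) | greatest k P P0
... | yes Pk+1 | _            = suc k , Pk+1 , λ n n≤k+1 _ → n≤k+1
... | no ¬Pk+1 | m , Pm , max = m , Pm , max′
  where
  max′ : ∀ n → n ≤ suc k → T (P n) → n ≤ m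
  max′ n n≤k+1 Pn with m≤n⇒m<n∨m≡n n≤k+1
  ... | inj₁ n<k+1 = max n (≤-pred n<k+1) Pn
  ... | inj₂ refl  = contradiction Pn ¬Pk+1

module IntervalDecomposition {k} (A B : NSet) ([k]≐A⊕B : ⟦ k ⟧ ≐ (A ⊕ B)) where

  ⊕⇒≤ : T ((A ⊕ B) n) → n ≤ k
  ⊕⇒≤ {n} n∈ = ≤ᵇ⇒≤ n k (subst T (sym ([k]≐A⊕B n)) n∈)

  ≤⇒⊕ : n ≤ k → T ((A ⊕ B) n)
  ≤⇒⊕ n≤k = subst T ([k]≐A⊕B _) (≤⇒≤ᵇ n≤k)

  0∈summands : T (A 0) × T (B 0)
  0∈summands with ∈-⊕⁻ A B 0 (≤⇒⊕ z≤n)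
  ... | zero , zero , A0 , B0 , _ = A0 , B0
  ... | zero , suc _ , _ , _ , ()
  ... | suc _ , _ , _ , _ , ()

summand⇒coverable : Summand ⟦ k ⟧ A → Coverable k A
summand⇒coverable {k} {A} (B , [k]≐A⊕B)
  with A0 , B0 ← IntervalDecomposition.0∈summands A B [k]≐A⊕B
  with t , Bt , maxB ← greatest k B B0 = t , bound , cover
  where
  open IntervalDecomposition A B [k]≐A⊕B
  bound : ∀ a → T (A a) → a + t ≤ k
  bound a Aa = ⊕⇒≤ (∈-⊕⁺ A B Aa Bt)
  cover : ∀ n → n ≤ k → ∃[ a ] a ≤ n × T (A a) × n ≤ a + t
  cover n n≤k with a , b , Aa , Bb , refl ← ∈-⊕⁻ A B n (≤⇒⊕ n≤k) =
    a , m≤m+n a b , Aa , +-monoʳ-≤ a (maxB b (⊕⇒≤ (∈-⊕⁺ A B A0 Bb)) Bb)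

fromBits : List Bool → NSet
fromBits []       _       = false
fromBits (b ∷ _)  zero    = b
fromBits (_ ∷ bs) (suc i) = fromBits bs i

fromBits-< : ∀ u {i} → T (fromBits u i) → i < length u
fromBits-< (_ ∷ _)  {zero}  _  = s≤s z≤n
fromBits-< (_ ∷ bs) {suc i} bi = s≤s (fromBits-< bs bi)

covers? : ∀ k t u → Dec (Covers k t (fromBits u))
covers? k t u = map′ toCovers fromCovers (allUpTo? bounded? (length u) ×-dec allUpTo? covered? (suc k))
  where
  Bounded : Pred ℕ _
  Bounded a = T (fromBits u a) → a + t ≤ k
  Covered : Pred ℕ _
  Covered n = ∃[ a ] a < suc n × T (fromBits u a) × n ≤ a + t
  bounded? : Decidable Bounded
  bounded? a = T? (fromBits u a) →-dec a + t ≤? k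
  covered? : Decidable Covered
  covered? n = anyUpTo? (λ a → T? (fromBits u a) ×-dec n ≤? a + t) (suc n)
  toCovers : (∀ {a} → a < length u → Bounded a) × (∀ {n} → n < suc k → Covered n) → Covers k t (fromBits u)
  toCovers (bound , cover) =
    (λ a Aa → bound (fromBits-< u Aa) Aa) ,
    (λ n n≤k → let a , a<n+1 , Aa∧n≤a+t = cover (s≤s n≤k) in a , ≤-pred a<n+1 , Aa∧n≤a+t)
  fromCovers : Covers k t (fromBits u) → (∀ {a} → a < length u → Bounded a) × (∀ {n} → n < suc k → Covered n)
  fromCovers (bound , cover) =
    (λ {a} _ → bound a) ,
    (λ { {n} (s≤s n≤k) → let a , a≤n , Aa∧n≤a+t = cover n n≤k in a , s≤s a≤n , Aa∧n≤a+t })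

coverable? : ∀ k → Decidable (Coverable k ∘ fromBits)
coverable? k u = map′ (λ (t , _ , c) → t , c) (λ (t , c) → t , s≤s (covers⇒t≤k c) , c)
  (anyUpTo? (λ t → covers? k t u) (suc k))

covers-shift⁻ : T (A 1) → Covers (suc k) t A → Covers k t (A ∘ suc)
covers-shift⁻ {A} {k} {t} A1 (bound , cover) = (λ a Aa+1 → ≤-pred (bound (suc a) Aa+1)) , cover′
  where
  cover′ : ∀ n → n ≤ k → ∃[ a ] a ≤ n × T (A (suc a)) × n ≤ a + t
  cover′ n n≤k with cover (suc n) (s≤s n≤k)
  ... | zero  , _      , _    , n<t       = 0 , z≤n , A1 , <⇒≤ n<t
  ... | suc a , a<n+1 , Aa+1 , n+1≤a+1+t = a , ≤-pred a<n+1 , Aa+1 , ≤-pred n+1≤a+1+t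

covers-shift⁺ : T (A 0) → Covers k t (A ∘ suc) → Covers (suc k) t A
covers-shift⁺ {A} {k} {t} A0 c@(bound , cover) = bound′ , cover′
  where
  bound′ : ∀ a → T (A a) → a + t ≤ suc k
  bound′ zero    _  = m≤n⇒m≤1+n (bound 0 (covers⇒0∈ c))
  bound′ (suc a) Aa = s≤s (bound a Aa)
  cover′ : ∀ n → n ≤ suc k → ∃[ a ] a ≤ n × T (A a) × n ≤ a + t
  cover′ zero    _         = 0 , z≤n , A0 , z≤n
  cover′ (suc n) n+1≤k+1 with a , a≤n , Aa+1 , n≤a+t ← cover n (≤-pred n+1≤k+1) =
    suc a , s≤s a≤n , Aa+1 , s≤s n≤a+t

covers-delete-gap : ∀ u → Covers (suc k) t (fromBits (true ∷ false ∷ u)) → Coverable k (fromBits (true ∷ u))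
covers-delete-gap {k} {t} u (bound , cover) with t ≤? k
... | yes t≤k = t , bound′ , cover′
  where
  bound′ : ∀ a → T (fromBits (true ∷ u) a) → a + t ≤ k
  bound′ zero    _  = t≤k
  bound′ (suc a) Aa = ≤-pred (bound (suc (suc a)) Aa)
  cover′ : ∀ n → n ≤ k → ∃[ a ] a ≤ n × T (fromBits (true ∷ u) a) × n ≤ a + t
  cover′ n n≤k with cover (suc n) (s≤s n≤k)
  ... | zero , _ , _ , n<t = 0 , z≤n , _ , <⇒≤ n<t
  ... | suc zero , _ , () , _
  ... | suc (suc a) , a+2≤n+1 , Aa , n+1≤a+2+t = suc a , ≤-pred a+2≤n+1 , Aa , ≤-pred n+1≤a+2+t
... | no t≰k = k , bound′ , λ n n≤k → 0 , z≤n , _ , n≤k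
  where
  bound′ : ∀ a → T (fromBits (true ∷ u) a) → a + k ≤ k
  bound′ zero    _  = ≤-refl
  bound′ (suc a) Aa = contradiction (m+n≤o⇒n≤o (suc a) (≤-pred (bound (suc (suc a)) Aa))) t≰k

covers-top⇒full : T (A k) → Covers k t A → ∀ n → n ≤ k → T (A n)
covers-top⇒full {A} {k} {t} Ak (bound , cover) n n≤k
  with refl ← n≤0⇒n≡0 (+-cancelˡ-≤ k t 0 (subst (k + t ≤_) (sym (+-identityʳ k)) (bound k Ak)))
  with a , a≤n , Aa , n≤a+0 ← cover n n≤k =
  subst (T ∘ A) (≤-antisym a≤n (subst (n ≤_) (+-identityʳ a) n≤a+0)) Aa

fromBits-replicate : ∀ {i} n → i < n → T (fromBits (replicate n true) i)
fromBits-replicate {zero}  (suc n) _       = _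
fromBits-replicate {suc i} (suc n) i+1<n+1 = fromBits-replicate n (≤-pred i+1<n+1)

coverable-interval : ∀ k → Coverable k (fromBits (replicate (suc k) true))
coverable-interval k = 0 , bound , λ n n≤k → n , ≤-refl , fromBits-replicate (suc k) (s≤s n≤k) , m≤m+n n 0
  where
  bound : ∀ a → T (fromBits (replicate (suc k) true) a) → a + 0 ≤ k
  bound a Aa = subst (_≤ k) (sym (+-identityʳ a))
    (≤-pred (subst (a <_) (length-replicate (suc k)) (fromBits-< (replicate (suc k) true) Aa)))

fromBits-applyUpTo : ∀ n A → (∀ i → T (A i) → i < n) → fromBits (applyUpTo A n) ≐ A
fromBits-applyUpTo zero A A<0 i with A i | A<0 i
... | false | _   = refl
... | true  | i<0 = contradiction (i<0 _) λ ()
fromBits-applyUpTo (suc n) A A<n+1 zero    = refl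
fromBits-applyUpTo (suc n) A A<n+1 (suc i) = fromBits-applyUpTo n (A ∘ suc) (λ i Ai+1 → ≤-pred (A<n+1 (suc i) Ai+1)) i

bitStrings : ℕ → List (List Bool)
bitStrings zero    = [] ∷ []
bitStrings (suc n) = map (true ∷_) (bitStrings n) ++ map (false ∷_) (bitStrings n)

∈-bitStrings : ∀ u → u ∈ bitStrings (length u)
∈-bitStrings []          = here refl
∈-bitStrings (true ∷ u)  = ∈-++⁺ˡ (∈-map⁺ (true ∷_) (∈-bitStrings u))
∈-bitStrings (false ∷ u) = ∈-++⁺ʳ (map (true ∷_) (bitStrings (length u))) (∈-map⁺ (false ∷_) (∈-bitStrings u))

bitStrings-distinct : ∀ n → AllPairs (λ u v → ¬ fromBits u ≐ fromBits v) (bitStrings n)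
bitStrings-distinct zero    = [] ∷ []
bitStrings-distinct (suc n) = AllPairs.++⁺ (consDistinct true) (consDistinct false)
  (All.map⁺ (All.universal (λ _ → All.map⁺ (All.universal (λ _ eq → case eq 0 of λ ()) strings)) strings))
  where
  strings = bitStrings n
  consDistinct : ∀ b → AllPairs (λ u v → ¬ fromBits u ≐ fromBits v) (map (b ∷_) strings)
  consDistinct b = AllPairs.map⁺ (AllPairs.map (λ u≠v eq → u≠v (eq ∘ suc)) (bitStrings-distinct n))

count : {P : Pred X ℓ} → Decidable P → List X → ℕ
count P? xs = length (filter P? xs)

module _ {P : Pred X ℓ} (P? : Decidable P) where

  count-++ : ∀ xs ys → count P? (xs ++ ys) ≡ count P? xs + count P? ys
  count-++ xs ys = trans (cong length (filter-++ P? xs ys)) (length-++ (filter P? xs))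

  count-map : (f : Y → X) → ∀ xs → count P? (map f xs) ≡ count (P? ∘ f) xs
  count-map f []       = refl
  count-map f (x ∷ xs) with does (P? (f x))
  ... | true  = cong suc (count-map f xs)
  ... | false = count-map f xs

  count-none : (∀ x → ¬ P x) → ∀ xs → count P? xs ≡ 0
  count-none ¬P xs = cong length (filter-none P? (All.universal ¬P xs))

count-bitStrings : {P : Pred (List Bool) ℓ} (P? : Decidable P) → ∀ n →
  count P? (bitStrings (suc n)) ≡ count (P? ∘ (true ∷_)) (bitStrings n) + count (P? ∘ (false ∷_)) (bitStrings n)
count-bitStrings P? n = begin
  count P? (map (true ∷_) strings ++ map (false ∷_) strings)
    ≡⟨ count-++ P? (map (true ∷_) strings) _ ⟩
  count P? (map (true ∷_) strings) + count P? (map (false ∷_) strings)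
    ≡⟨ cong₂ _+_ (count-map P? (true ∷_) strings) (count-map P? (false ∷_) strings) ⟩
  count (P? ∘ (true ∷_)) strings + count (P? ∘ (false ∷_)) strings ∎
  where
  open ≡-Reasoning
  strings = bitStrings n

module _ {P : Pred X ℓ} {Q : Pred X ℓ′} (P? : Decidable P) (Q? : Decidable Q) (Q⊆P : Q ⊆ P) where

  filter-filter-⊆ : ∀ xs → filter Q? (filter P? xs) ≡ filter Q? xs
  filter-filter-⊆ []       = refl
  filter-filter-⊆ (x ∷ xs) with P? x
  ... | yes _ with Q? x
  ...   | yes _ = cong (x ∷_) (filter-filter-⊆ xs)
  ...   | no _  = filter-filter-⊆ xs
  filter-filter-⊆ (x ∷ xs) | no ¬Px with Q? x
  ...   | yes Qx = contradiction (Q⊆P Qx) ¬Px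
  ...   | no _   = filter-filter-⊆ xs

  count-mono : ∀ xs → count Q? xs ≤ count P? xs
  count-mono xs = subst (_≤ count P? xs) (cong length (filter-filter-⊆ xs)) (length-filter Q? (filter P? xs))

  count-mono-< : ∀ {x xs} → x ∈ xs → P x → ¬ Q x → count Q? xs < count P? xs
  count-mono-< {x} {xs} x∈xs Px ¬Qx = subst (_< count P? xs) (cong length (filter-filter-⊆ xs))
    (filter-notAll Q? (filter P? xs) (Any.map (λ { refl → ¬Qx }) (∈-filter⁺ P? x∈xs Px)))

summandCount : ℕ → ℕ
summandCount k = count (coverable? k) (bitStrings (suc k))

dCount-interval : ∀ k → DCount ⟦ k ⟧ (summandCount k)
dCount-interval k =
  map fromBits codes , length-map fromBits codes ,
  All.map⁺ (All.map (λ (_ , c) → covers⇒summand c) (all-filter (coverable? k) (bitStrings (suc k)))) ,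
  AllPairs.map⁺ (AllPairs.filter⁺ (coverable? k) (bitStrings-distinct (suc k))) ,
  complete
  where
  codes = filter (coverable? k) (bitStrings (suc k))
  complete : ∀ A → Summand ⟦ k ⟧ A → Any (A ≐_) (map fromBits codes)
  complete A s with t , c ← summand⇒coverable s =
    Any.map (λ { refl i → sym (code≐A i) }) (∈-map⁺ fromBits code∈codes)
    where
    code = applyUpTo A (suc k)
    code≐A : fromBits code ≐ A
    code≐A = fromBits-applyUpTo (suc k) A (λ i Ai → s≤s (covers⇒⊆ c i Ai))
    code∈codes : code ∈ codes
    code∈codes = ∈-filter⁺ (coverable? k)
      (subst (λ n → code ∈ bitStrings n) (length-applyUpTo A (suc k)) (∈-bitStrings code))
      (t , covers-resp-≐ (λ i → sym (code≐A i)) c)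

headCount : ℕ → ℕ
headCount k = count (coverable? k ∘ (true ∷_)) (bitStrings k)

gapCount : ℕ → ℕ
gapCount k = count (coverable? (suc k) ∘ (λ u → true ∷ false ∷ u)) (bitStrings k)

summandCount≡headCount : ∀ k → summandCount k ≡ headCount k
summandCount≡headCount k = begin
  summandCount k
    ≡⟨ count-bitStrings (coverable? k) k ⟩
  headCount k + count (coverable? k ∘ (false ∷_)) (bitStrings k)
    ≡⟨ cong (headCount k +_) (count-none (coverable? k ∘ (false ∷_)) (λ _ (_ , c) → covers⇒0∈ c) (bitStrings k)) ⟩
  headCount k + 0
    ≡⟨ +-identityʳ (headCount k) ⟩
  headCount k ∎
  where open ≡-Reasoning

summandCount-suc : ∀ k → summandCount (suc k) ≡ summandCount k + gapCount k
summandCount-suc k = begin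
  summandCount (suc k)
    ≡⟨ summandCount≡headCount (suc k) ⟩
  headCount (suc k)
    ≡⟨ count-bitStrings (coverable? (suc k) ∘ (true ∷_)) k ⟩
  count (coverable? (suc k) ∘ (λ u → true ∷ true ∷ u)) (bitStrings k) + gapCount k
    ≡⟨ cong (_+ gapCount k) (cong length (filter-≐ _ (coverable? k ∘ (true ∷_)) shift (bitStrings k))) ⟩
  headCount k + gapCount k
    ≡⟨ cong (_+ gapCount k) (sym (summandCount≡headCount k)) ⟩
  summandCount k + gapCount k ∎
  where
  open ≡-Reasoning
  shift : (Coverable (suc k) ∘ fromBits ∘ (λ u → true ∷ true ∷ u)) ≐ᵖ (Coverable k ∘ fromBits ∘ (true ∷_))
  shift = (λ (t , c) → t , covers-shift⁻ _ c) , (λ (t , c) → t , covers-shift⁺ _ c)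

gapCount≤summandCount : ∀ k → gapCount k ≤ summandCount k
gapCount≤summandCount k = subst (gapCount k ≤_) (sym (summandCount≡headCount k))
  (count-mono (coverable? k ∘ (true ∷_)) _ (λ (_ , c) → covers-delete-gap _ c) (bitStrings k))

gapCount<summandCount : ∀ k → 1 ≤ k → gapCount k < summandCount k
gapCount<summandCount (suc k) _ = subst (gapCount (suc k) <_) (sym (summandCount≡headCount (suc k)))
  (count-mono-< (coverable? (suc k) ∘ (true ∷_)) _ (λ (_ , c) → covers-delete-gap _ c)
    ones∈bitStrings (coverable-interval (suc k)) gapped-ones-uncoverable)
  where
  ones = replicate (suc k) true
  ones∈bitStrings : ones ∈ bitStrings (suc k)
  ones∈bitStrings = subst (λ n → ones ∈ bitStrings n) (length-replicate (suc k)) (∈-bitStrings ones)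
  gapped-ones-uncoverable : ¬ Coverable (suc (suc k)) (fromBits (true ∷ false ∷ ones))
  gapped-ones-uncoverable (_ , c) = covers-top⇒full (fromBits-replicate (suc k) ≤-refl) c 1 (s≤s z≤n)

mainTheorem6 : (j : ℕ) →
    Σ ℕ (λ m → Σ ℕ (λ n →
      DCount ⟦ j ⟧ m × DCount ⟦ suc j ⟧ n × n ≤ 2 * m × (1 ≤ j → n < 2 * m)))
mainTheorem6 j =
  m , summandCount (suc j) , dCount-interval j , dCount-interval (suc j) ,
  subst (_≤ 2 * m) (sym (summandCount-suc j)) (+-monoʳ-≤ m (≤-trans (gapCount≤summandCount j) m≤m+0)) ,
  λ 1≤j → subst (_< 2 * m) (sym (summandCount-suc j)) (+-monoʳ-< m (<-≤-trans (gapCount<summandCount j 1≤j) m≤m+0))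
  where
  m = summandCount j
  -- 2 * m reduces to m + (m + 0).
  m≤m+0 : m ≤ m + 0
  m≤m+0 = m≤m+n m 0
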